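{- For every decoder $D=([k],A)$ there exists an MSO formula $\varphi_D(X,X_1,\ldots,X_k)$, whose length is linear in the size of $D$, such that for every graph $G$, every $Z\subseteq V(G)$ and every map $\ell:Z\to[k]$, there is an ordering $c$ such that $(\ell,c)$ is a letter realisation of $G[Z]$ over $D$ if and only if $G$ satisfies $\varphi_D(Z,\ell^{ -1}(1),\ldots,\ell^{ -1}(k))$.
   Context: A decoder is a directed graph $D=(\Sigma,A)$ (loops allowed); here $\Sigma=[k]=\{1,\dots,k\}$, and the size of $D$ is its number of vertices plus arcs. An $n$-vertex graph $H=(V,E)$ has letter realisation $(\ell,c)$ over $D$, where $\ell:V\to\Sigma$ and $c:V\to[n]$ is a bijection, if two distinct vertices $x,y$ are adjacent iff either $(\ell(x),\ell(y))\in A$ and $c(x)<c(y)$, or $(\ell(y),\ell(x))\in A$ and $c(y)<c(x)$. MSO formulas over graphs are built from atomic formulas $x=y$, $\mathsf{edg}(x,y)$ (adjacency) and $x\in X$, with vertex variables (lower case) and vertex-set variables (upper case), using $\wedge,\vee,\neg$ and existential quantification over both kinds of variables, with the usual semantics; $G$ satisfies $\varphi(U,U_1,\dots)$ if the formula is true in $G$ when the free set variables are interpreted by the given vertex sets. The length of a formula is its number of symbols. -}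

module Defs where

open import Data.Nat using (ℕ; zero; suc; _+_)
open import Data.Nat.ListAction using (sum)
open import Data.Bool using (Bool; true; false; T; if_then_else_)
open import Data.Fin using (Fin; zero; suc; _≟_; _<_)
open import Data.Fin.Subset using (Subset; _∈_; _∉_; ∣_∣)
open import Data.Fin.Subset.Properties using (_∈?_)
open import Data.List using (List; map; allFin)
open import Data.Vec using (tabulate)
open import Data.Product using (Σ; ∃; _×_; _,_; proj₁)
open import Data.Sum using (_⊎_)
open import Data.Empty using (⊥)
open import Relation.Nullary using (¬_; yes; no; does)
open import Relation.Binary.PropositionalEquality using (_≡_; _≢_)
open import Function.Bundles using (_⤖_; Bijection; _⇔_)

-- Decoders: a digraph on Σ = [k] (here Fin k), loops allowed;
-- the arc set is given as a Boolean adjacency matrix.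

record Decoder : Set where
  field
    k   : ℕ
    arc : Fin k → Fin k → Bool

open Decoder public

nArcs : Decoder → ℕ
nArcs D = sum (map (λ i → sum (map (λ j → if arc D i j then 1 else 0)
                                     (allFin (k D))))
                   (allFin (k D)))

size : Decoder → ℕ
size D = k D + nArcs D

record Graph : Set where
  field
    n       : ℕ
    adj     : Fin n → Fin n → Bool
    sym     : ∀ x y → adj x y ≡ adj y x
    irrefl  : ∀ x → adj x x ≡ false

open Graph public

-- Letter realisation (ℓ , c) of a graph given by a vertex type V with
-- adjacency relation E and m = |V| vertices, over decoder D.
-- c : V → [m] is a bijection (here onto Fin m, i.e. 0-based positions).

IsLetterRealisation : (D : Decoder) {V : Set} (E : V → V → Set) (m : ℕ)
                      (ℓ : V → Fin (k D)) (c : V ⤖ Fin m) → Set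
IsLetterRealisation D {V} E m ℓ c =
  ∀ (x y : V) → x ≢ y →
    E x y ⇔ ((T (arc D (ℓ x) (ℓ y)) × Bijection.to c x < Bijection.to c y)
             ⊎ (T (arc D (ℓ y) (ℓ x)) × Bijection.to c y < Bijection.to c x))

VZ : (G : Graph) → Subset (n G) → Set
VZ G Z = Σ (Fin (n G)) (λ x → x ∈ Z)

EZ : (G : Graph) (Z : Subset (n G)) → VZ G Z → VZ G Z → Set
EZ G Z (x , _) (y , _) = T (adj G x y)

-- MSO formulas over graphs; de Bruijn indexed variables:
-- Formula v s has v vertex variables and s vertex-set variables in scope.

data Formula : ℕ → ℕ → Set where
  eq    : ∀ {v s} → Fin v → Fin v → Formula v s
  edg   : ∀ {v s} → Fin v → Fin v → Formula v s
  mem   : ∀ {v s} → Fin v → Fin s → Formula v s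
  and   : ∀ {v s} → Formula v s → Formula v s → Formula v s
  or    : ∀ {v s} → Formula v s → Formula v s → Formula v s
  neg   : ∀ {v s} → Formula v s → Formula v s
  exV   : ∀ {v s} → Formula (suc v) s → Formula v s
  exS   : ∀ {v s} → Formula v (suc s) → Formula v s

-- length = number of symbols (each variable occurrence is one symbol;
-- binary connectives counted with a pair of parentheses)
len : ∀ {v s} → Formula v s → ℕ
len (eq _ _)  = 3
len (edg _ _) = 6      -- edg ( x , y )
len (mem _ _) = 3
len (and φ ψ) = len φ + len ψ + 3
len (or φ ψ)  = len φ + len ψ + 3
len (neg φ)   = len φ + 1
len (exV φ)   = len φ + 2
len (exS φ)   = len φ + 2

Sat : (G : Graph) {v s : ℕ} → (Fin v → Fin (n G)) → (Fin s → Subset (n G))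
      → Formula v s → Set
Sat G ρ σ (eq x y)  = ρ x ≡ ρ y
Sat G ρ σ (edg x y) = T (adj G (ρ x) (ρ y))
Sat G ρ σ (mem x X) = ρ x ∈ σ X
Sat G ρ σ (and φ ψ) = Sat G ρ σ φ × Sat G ρ σ ψ
Sat G ρ σ (or φ ψ)  = Sat G ρ σ φ ⊎ Sat G ρ σ ψ
Sat G ρ σ (neg φ)   = ¬ Sat G ρ σ φ
Sat G ρ σ (exV φ)   = Σ (Fin (n G)) λ a → Sat G (extend a ρ) σ φ
  where
  extend : ∀ {A : Set} {v} → A → (Fin v → A) → Fin (suc v) → A
  extend a f zero    = a
  extend a f (suc i) = f i
Sat G ρ σ (exS φ)   = Σ (Subset (n G)) λ U → Sat G ρ (extend U σ) φ
  where
  extend : ∀ {A : Set} {s} → A → (Fin s → A) → Fin (suc s) → A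
  extend a f zero    = a
  extend a f (suc i) = f i

noVars : {A : Set} → Fin 0 → A
noVars ()

Labelling : (G : Graph) (Z : Subset (n G)) (k : ℕ) → Set
Labelling G Z k = (x : Fin (n G)) → x ∈ Z → Fin k

preimage : (G : Graph) (Z : Subset (n G)) {k : ℕ} → Labelling G Z k → Fin k
           → Subset (n G)
preimage G Z ℓ i = tabulate λ x → helper x (x ∈? Z)
  where
  open import Relation.Nullary using (Dec)
  helper : (x : Fin (n G)) → Dec (x ∈ Z) → Bool
  helper x (yes p) = does (ℓ x p ≟ i)
  helper x (no _)  = false

assignment : (G : Graph) (Z : Subset (n G)) {k : ℕ} → Labelling G Z k
             → Fin (suc k) → Subset (n G)
assignment G Z ℓ zero    = Z
assignment G Z ℓ (suc i) = preimage G Z ℓ i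

labelZ : (G : Graph) (Z : Subset (n G)) {k : ℕ} → Labelling G Z k
         → VZ G Z → Fin k
labelZ G Z ℓ (x , p) = ℓ x p

-- Call an ordered pair (x, y) of distinct vertices of G[Z] a conflict when the adjacency of x and y
-- disagrees with the presence of the arc ℓ(x) → ℓ(y) in D. For c(x) < c(y) the definition of a
-- letter realisation says exactly that (x, y) is not a conflict, so (ℓ, c) is a realisation iff c
-- puts y before x for every conflict (x, y). Such an ordering exists iff the conflict digraph is
-- acyclic: an ordering makes it well-founded, and conversely a topological sort (repeatedly
-- removing a sink) produces one. Acyclicity is the MSO property "no nonempty Y ⊆ Z in which every
-- vertex has a conflict successor", and the only part of that formula whose length grows with D is
-- the disjunction over the arcs of D expressing "ℓ(x) → ℓ(y) is an arc".

module Submission where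

open import Defs
open import Data.Nat using (ℕ; zero; suc; s≤s; z≤n; _+_; _*_; _≤_)
open import Data.Nat.ListAction using (sum)
open import Data.Nat.Properties using (*-zeroʳ; *-suc; m≤m+n; module ≤-Reasoning)
open import Data.Nat.Tactic.RingSolver using (solve-∀)
open import Data.Bool using (Bool; true; false; T; if_then_else_)
open import Data.Bool.Properties using () renaming (_≟_ to _≟ᵇ_)
open import Data.Fin using (Fin; zero; suc; _<_; punchIn; punchOut)
open import Data.Fin.Properties using (_≟_; <-cmp; <-asym; any?; all?; ¬∀⟶∃¬; punchIn-punchOut)
open import Data.Fin.Induction using (<-wellFounded)
open import Data.Fin.Permutation using (Permutation′; _⟨$⟩ʳ_; insert; insert-punchIn)
import Data.Fin.Permutation as Permutation
open import Data.Fin.Subset using (Subset; _∈_; _∉_; ∣_∣; Nonempty; ⊤)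
open import Data.Fin.Subset.Properties using (_∈?_; ∈⊤)
open import Data.List using (List; []; _∷_; map; filterᵇ; length; allFin)
open import Data.List.Properties using (map-cong; length-tabulate)
open import Data.List.Membership.Propositional using (find; lose)
open import Data.List.Membership.Propositional.Properties using (∈-allFin; ∈-filter⁺; ∈-filter⁻)
open import Data.List.Relation.Unary.Any using (Any; here; there)
open import Data.List.Relation.Unary.Any.Properties using (map⁺; map⁻)
open import Data.Vec using ([]; _∷_; here; there; lookup; tabulate; insertAt)
open import Data.Vec.Properties
  using (lookup∘tabulate; []=⇒lookup; lookup⇒[]=; []=↔lookup; insertAt-lookup; insertAt-punchIn)
open import Data.Vec.Properties.WithK using ([]=-irrelevant)
open import Data.Product using (Σ; ∃; ∃₂; _×_; _,_; proj₁; proj₂)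
open import Data.Sum using (_⊎_; inj₁; inj₂; [_,_]′)
open import Data.Empty using (⊥-elim)
open import Function.Base using (id; _∘_; _∋_; flip; _on_)
open import Function.Bundles using (_⤖_; _⇔_; _↔_; mk⇔; mk↔ₛ′; Equivalence; Bijection; Inverse)
open import Function.Construct.Composition using (_↔-∘_; _⇔-∘_)
open import Function.Construct.Identity using (⇔-id)
open import Function.Construct.Symmetry using (⇔-sym)
open import Function.Properties.Inverse using (↔⇒⤖)
open import Induction.WellFounded using (WellFounded; Acc; acc; module Subrelation)
open import Level using (0ℓ)
import Relation.Binary.Construct.On as On
open import Relation.Binary.Core using (Rel)
open import Relation.Binary.Definitions using (Decidable; tri<; tri≈; tri>)
open import Relation.Binary.PropositionalEquality using (_≡_; _≢_; refl; trans; subst; subst₂; cong)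
import Relation.Binary.PropositionalEquality as ≡
open import Relation.Nullary using (¬_; Dec; yes; no; does; contradiction)
open import Relation.Nullary.Decidable using (T?; dec-true; ¬?; _×-dec_; decidable-stable)

-- Orderings of finite digraphs

Descending : ∀ {A : Set} {m} → Rel A 0ℓ → (A → Fin m) → Set
Descending R f = ∀ {x y} → R x y → f y < f x

descending⇒wellFounded : ∀ {A : Set} {m} {R : Rel A 0ℓ} {f : A → Fin m} →
                         Descending R f → WellFounded (flip R)
descending⇒wellFounded {f = f} desc = Subrelation.wellFounded desc (On.wellFounded f <-wellFounded)

-- Stated with sets rather than cycles, as the MSO formula expresses it.
Acyclic : ∀ {m} → Rel (Fin m) 0ℓ → Set
Acyclic R = ∀ S → Nonempty S → ¬ (∀ {x} → x ∈ S → ∃ λ y → y ∈ S × R x y)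

sink : ∀ {m} {R : Rel (Fin (suc m)) 0ℓ} → Decidable R → Acyclic R → ∃ λ a → ∀ b → ¬ R a b
sink R? acyclic with all? (λ a → any? (R? a))
... | yes successor =
  ⊥-elim (acyclic ⊤ (zero , ∈⊤) λ {a} _ → proj₁ (successor a) , ∈⊤ , proj₂ (successor a))
... | no ¬successor =
  let a , ¬R = ¬∀⟶∃¬ _ _ (λ a → any? (R? a)) ¬successor in a , λ b r → ¬R (b , r)

punchIn-cover : ∀ {m} (a x : Fin (suc m)) → x ≡ a ⊎ ∃ λ i → x ≡ punchIn a i
punchIn-cover a x with a ≟ x
... | yes a≡x = inj₁ (≡.sym a≡x)
... | no a≢x  = inj₂ (punchOut a≢x , ≡.sym (punchIn-punchOut a≢x))

module _ {m} {S : Subset m} (a : Fin (suc m)) where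

  punchIn∈insertAt : ∀ {i} → i ∈ S → punchIn a i ∈ insertAt S a false
  punchIn∈insertAt {i} i∈S = Inverse.from []=↔lookup
    (trans (insertAt-punchIn S a false i) (Inverse.to []=↔lookup i∈S))

  punchIn∈insertAt⁻ : ∀ {i} → punchIn a i ∈ insertAt S a false → i ∈ S
  punchIn∈insertAt⁻ {i} i∈S′ = Inverse.from []=↔lookup
    (trans (≡.sym (insertAt-punchIn S a false i)) (Inverse.to []=↔lookup i∈S′))

  ∉insertAt : a ∉ insertAt S a false
  ∉insertAt a∈S′ with () ← trans (≡.sym (insertAt-lookup S a false)) (Inverse.to []=↔lookup a∈S′)

acyclic-punchIn : ∀ {m} {R : Rel (Fin (suc m)) 0ℓ} (a : Fin (suc m)) →
                  Acyclic R → Acyclic (R on punchIn a)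
acyclic-punchIn {R = R} a acyclic S (i , i∈S) closed =
  acyclic (insertAt S a false) (punchIn a i , punchIn∈insertAt a i∈S) closed′
  where
  closed′ : ∀ {x} → x ∈ insertAt S a false → ∃ λ y → y ∈ insertAt S a false × R x y
  closed′ {x} x∈S′ with punchIn-cover a x
  ... | inj₁ refl = contradiction x∈S′ (∉insertAt a)
  ... | inj₂ (i , refl) =
    let j , j∈S , r = closed (punchIn∈insertAt⁻ a x∈S′) in punchIn a j , punchIn∈insertAt a j∈S , r

insert-pivot : ∀ {m} (i j : Fin (suc m)) (π : Permutation′ m) → insert i j π ⟨$⟩ʳ i ≡ j
insert-pivot i j π with i ≟ i
... | yes _   = refl
... | no i≢i = contradiction refl i≢i

topologicalSort : ∀ {m} {R : Rel (Fin m) 0ℓ} → Decidable R → Acyclic R →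
                  ∃ λ (π : Permutation′ m) → Descending R (π ⟨$⟩ʳ_)
topologicalSort {zero}          R? acyclic = Permutation.id , λ { {()} }
topologicalSort {suc m} {R = R} R? acyclic = insert a zero π , descending
  where
  a = proj₁ (sink R? acyclic)
  sorted = topologicalSort (λ i j → R? (punchIn a i) (punchIn a j)) (acyclic-punchIn a acyclic)
  π = proj₁ sorted

  descending : Descending R (insert a zero π ⟨$⟩ʳ_)
  descending {x} {y} r with punchIn-cover a x | punchIn-cover a y
  ... | inj₁ refl       | _ = contradiction r (proj₂ (sink R? acyclic) y)
  ... | inj₂ (i , refl) | inj₁ refl
    rewrite insert-pivot a zero π | insert-punchIn a zero π i = s≤s z≤n
  ... | inj₂ (i , refl) | inj₂ (j , refl)
    rewrite insert-punchIn a zero π i | insert-punchIn a zero π j = s≤s (proj₂ sorted r)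

linearExtension : ∀ {A : Set} {m} {R : Rel A 0ℓ} (e : A ↔ Fin m) → Decidable R →
                  Acyclic (R on Inverse.from e) →
                  ∃ λ (c : A ⤖ Fin m) → Descending R (Bijection.to c)
linearExtension {R = R} e R? acyclic = ↔⇒⤖ (π ↔-∘ e) , descending
  where
  open Inverse e
  sorted = topologicalSort (λ i j → R? (from i) (from j)) acyclic
  π = proj₁ sorted

  descending : Descending R (λ x → π ⟨$⟩ʳ to x)
  descending {x} {y} r =
    proj₂ sorted (subst₂ R (≡.sym (strictlyInverseʳ x)) (≡.sym (strictlyInverseʳ y)) r)

-- Elements of a subset

∈-proj₁-injective : ∀ {n} {p : Subset n} {u v : Σ (Fin n) (_∈ p)} → proj₁ u ≡ proj₁ v → u ≡ v
∈-proj₁-injective {u = x , x∈p} {v = .x , x∈p′} refl = cong (x ,_) ([]=-irrelevant x∈p x∈p′)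

enumerate : ∀ {n} (p : Subset n) → Σ (Fin n) (_∈ p) ↔ Fin ∣ p ∣
enumerate p = mk↔ₛ′ (position p) (element p) (position-element p) (element-position p)
  where
  sucₑ : ∀ {n b} {p : Subset n} → Σ (Fin n) (_∈ p) → Σ (Fin (suc n)) (_∈ (b ∷ p))
  sucₑ (x , x∈p) = suc x , there x∈p

  position : ∀ {n} (p : Subset n) → Σ (Fin n) (_∈ p) → Fin ∣ p ∣
  position (true ∷ p)  (zero , here)        = zero
  position (true ∷ p)  (suc x , there x∈p)  = suc (position p (x , x∈p))
  position (false ∷ p) (suc x , there x∈p)  = position p (x , x∈p)

  element : ∀ {n} (p : Subset n) → Fin ∣ p ∣ → Σ (Fin n) (_∈ p)
  element (true ∷ p)  zero    = zero , here
  element (true ∷ p)  (suc i) = sucₑ (element p i)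
  element (false ∷ p) i       = sucₑ (element p i)

  position-element : ∀ {n} (p : Subset n) i → position p (element p i) ≡ i
  position-element (true ∷ p)  zero    = refl
  position-element (true ∷ p)  (suc i) = cong suc (position-element p i)
  position-element (false ∷ p) i       = position-element p i

  element-position : ∀ {n} (p : Subset n) v → element p (position p v) ≡ v
  element-position (true ∷ p)  (zero , here)       = refl
  element-position (true ∷ p)  (suc x , there x∈p) = cong sucₑ (element-position p (x , x∈p))
  element-position (false ∷ p) (suc x , there x∈p) = cong sucₑ (element-position p (x , x∈p))

-- Derived connectives and counting

≡⇒⇔ : ∀ {A B : Set} → A ≡ B → A ⇔ B
≡⇒⇔ refl = ⇔-id _

T⇔T⇒≡ : ∀ {a b} → (T a ⇔ T b) → a ≡ b
T⇔T⇒≡ {false} {false} _   = refl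
T⇔T⇒≡ {false} {true}  a⇔b = contradiction (Equivalence.from a⇔b _) λ ()
T⇔T⇒≡ {true}  {false} a⇔b = contradiction (Equivalence.to a⇔b _) λ ()
T⇔T⇒≡ {true}  {true}  _   = refl

⊥ᶠ : ∀ {v s} → Formula (suc v) s
⊥ᶠ = neg (eq zero zero)

⋁ : ∀ {v s} → List (Formula (suc v) s) → Formula (suc v) s
⋁ []       = ⊥ᶠ
⋁ (φ ∷ φs) = or φ (⋁ φs)

_⊻_ : ∀ {v s} → Formula v s → Formula v s → Formula v s
φ ⊻ ψ = or (and φ (neg ψ)) (and (neg φ) ψ)

module _ {G : Graph} {v s : ℕ} {σ : Fin s → Subset (n G)} where

  open Equivalence

  Sat-⋁ : ∀ {ρ : Fin (suc v) → Fin (n G)} (φs : List (Formula (suc v) s)) →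
          Sat G ρ σ (⋁ φs) ⇔ Any (Sat G ρ σ) φs
  Sat-⋁ []       = mk⇔ (λ ¬refl → contradiction refl ¬refl) λ ()
  Sat-⋁ (φ ∷ φs) = mk⇔ [ here , there ∘ to (Sat-⋁ φs) ]′
                       λ { (here sφ) → inj₁ sφ ; (there sφs) → inj₂ (from (Sat-⋁ φs) sφs) }

  Sat-⊻ : ∀ {ρ : Fin v → Fin (n G)} {φ ψ a b} → Sat G ρ σ φ ⇔ T a → Sat G ρ σ ψ ⇔ T b →
          Sat G ρ σ (φ ⊻ ψ) ⇔ (a ≢ b)
  Sat-⊻ {a = true}  {true}  φ⇔a ψ⇔b = mk⇔
    (λ { (inj₁ (_ , ¬sψ)) _ → ¬sψ (from ψ⇔b _) ; (inj₂ (¬sφ , _)) _ → ¬sφ (from φ⇔a _) })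
    (λ a≢b → contradiction refl a≢b)
  Sat-⊻ {a = true}  {false} φ⇔a ψ⇔b = mk⇔ (λ _ ()) (λ _ → inj₁ (from φ⇔a _ , to ψ⇔b))
  Sat-⊻ {a = false} {true}  φ⇔a ψ⇔b = mk⇔ (λ _ ()) (λ _ → inj₂ (to φ⇔a , from ψ⇔b _))
  Sat-⊻ {a = false} {false} φ⇔a ψ⇔b = mk⇔
    (λ { (inj₁ (sφ , _)) _ → to φ⇔a sφ ; (inj₂ (_ , sψ)) _ → to ψ⇔b sψ })
    (λ a≢b → contradiction refl a≢b)

len-⋁-map : ∀ {A : Set} {v s} (f : A → Formula (suc v) s) xs →
            len (⋁ (map f xs)) ≡ sum (map (λ x → len (f x) + 3) xs) + 4
len-⋁-map f []       = refl
len-⋁-map f (x ∷ xs) rewrite len-⋁-map f xs = reassoc (len (f x)) (sum (map (λ x → len (f x) + 3) xs))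
  where
  reassoc : ∀ a b → a + (b + 4) + 3 ≡ a + 3 + b + 4
  reassoc = solve-∀

module _ {A : Set} where

  length-filterᵇ : ∀ (p : A → Bool) xs →
                   length (filterᵇ p xs) ≡ sum (map (λ x → if p x then 1 else 0) xs)
  length-filterᵇ p []       = refl
  length-filterᵇ p (x ∷ xs) with p x
  ... | true  = cong suc (length-filterᵇ p xs)
  ... | false = length-filterᵇ p xs

  sum-map-const : ∀ c (xs : List A) → sum (map (λ _ → c) xs) ≡ c * length xs
  sum-map-const c []       = ≡.sym (*-zeroʳ c)
  sum-map-const c (x ∷ xs) rewrite sum-map-const c xs = ≡.sym (*-suc c (length xs))

  sum-map-affine : ∀ a b (f : A → ℕ) xs →
                   sum (map (λ x → a * f x + b) xs) ≡ a * sum (map f xs) + b * length xs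
  sum-map-affine a b f []       = ≡.sym (≡.cong₂ _+_ (*-zeroʳ a) (*-zeroʳ b))
  sum-map-affine a b f (x ∷ xs) rewrite sum-map-affine a b f xs =
    shuffle a b (f x) (sum (map f xs)) (length xs)
    where
    shuffle : ∀ a b y s l → a * y + b + (a * s + b * l) ≡ a * (y + s) + b * suc l
    shuffle = solve-∀

module DecoderFormula (D : Decoder) where

  varY varZ : Fin (2 + k D)
  varY = zero
  varZ = suc zero

  varℓ : Fin (k D) → Fin (2 + k D)
  varℓ i = suc (suc i)

  varx vary : Fin 2
  varx = suc zero
  vary = zero

  outNeighbours : Fin (k D) → List (Fin (k D))
  outNeighbours i = filterᵇ (arc D i) (allFin (k D))

  outDegree : Fin (k D) → ℕ
  outDegree i = sum (map (λ j → if arc D i j then 1 else 0) (allFin (k D)))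

  arcFrom : Fin (k D) → Formula 2 (2 + k D)
  arcFrom i = and (mem varx (varℓ i)) (⋁ (map (mem vary ∘ varℓ) (outNeighbours i)))

  arcFormula : Formula 2 (2 + k D)
  arcFormula = ⋁ (map arcFrom (allFin (k D)))

  conflictFormula : Formula 2 (2 + k D)
  conflictFormula = edg varx vary ⊻ arcFormula

  hasConflictSuccessor : Formula 1 (2 + k D)
  hasConflictSuccessor =
    and (mem zero varZ)
        (exV (and (mem vary varZ) (and (mem vary varY) (and (neg (eq vary varx)) conflictFormula))))

  -- ¬ ∃Y. (∃x. x ∈ Y) ∧ ∀x ∈ Y. (x ∈ Z ∧ ∃y. y ∈ Z ∧ y ∈ Y ∧ y ≠ x ∧ conflict(x, y))
  realisable : Formula 0 (suc (k D))
  realisable =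
    neg (exS (and (exV (mem zero varY)) (neg (exV (and (mem zero varY) (neg hasConflictSuccessor))))))

  Sat-arcFormula : ∀ {G ρ σ} → Sat G ρ σ arcFormula ⇔
                   ∃₂ λ i j → T (arc D i j) × ρ varx ∈ σ (varℓ i) × ρ vary ∈ σ (varℓ j)
  Sat-arcFormula {G} {ρ} {σ} = mk⇔ pick place
    where
    open Equivalence

    pick : Sat G ρ σ arcFormula → ∃₂ λ i j → T (arc D i j) × ρ varx ∈ σ (varℓ i) × ρ vary ∈ σ (varℓ j)
    pick s with find (map⁻ (to (Sat-⋁ (map arcFrom (allFin (k D)))) s))
    ... | i , _ , x∈ , s′ with find (map⁻ (to (Sat-⋁ (map (mem vary ∘ varℓ) (outNeighbours i))) s′))
    ... | j , j∈out , y∈ = i , j , proj₂ (∈-filter⁻ (T? ∘ arc D i) {xs = allFin (k D)} j∈out) , x∈ , y∈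

    place : (∃₂ λ i j → T (arc D i j) × ρ varx ∈ σ (varℓ i) × ρ vary ∈ σ (varℓ j)) → Sat G ρ σ arcFormula
    place (i , j , t , x∈ , y∈) = from (Sat-⋁ _) (map⁺ (lose (∈-allFin i)
      (x∈ , from (Sat-⋁ _) (map⁺ (lose (∈-filter⁺ (T? ∘ arc D i) (∈-allFin j) t) y∈)))))

  len-arcFormula : len arcFormula ≡ 6 * nArcs D + 13 * k D + 4
  len-arcFormula = begin
    len arcFormula                                            ≡⟨ len-⋁-map arcFrom (allFin (k D)) ⟩
    sum (map (λ i → len (arcFrom i) + 3) (allFin (k D))) + 4   ≡⟨ cong (λ t → sum t + 4) (map-cong len-arcFrom (allFin (k D))) ⟩
    sum (map (λ i → 6 * outDegree i + 13) (allFin (k D))) + 4  ≡⟨ cong (_+ 4) (sum-map-affine 6 13 outDegree (allFin (k D))) ⟩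
    6 * nArcs D + 13 * length (allFin (k D)) + 4              ≡⟨ cong (λ l → 6 * nArcs D + 13 * l + 4) (length-tabulate {n = k D} id) ⟩
    6 * nArcs D + 13 * k D + 4                                ∎
    where
    open ≡.≡-Reasoning

    len-arcFrom : ∀ i → len (arcFrom i) + 3 ≡ 6 * outDegree i + 13
    len-arcFrom i = begin
      3 + len (⋁ (map (mem vary ∘ varℓ) (outNeighbours i))) + 3 + 3 ≡⟨ cong (λ t → 3 + t + 3 + 3) (len-⋁-map (mem vary ∘ varℓ) (outNeighbours i)) ⟩
      3 + (sum (map (λ _ → 6) (outNeighbours i)) + 4) + 3 + 3       ≡⟨ cong (λ t → 3 + (t + 4) + 3 + 3) (sum-map-const 6 (outNeighbours i)) ⟩
      3 + (6 * length (outNeighbours i) + 4) + 3 + 3                ≡⟨ cong (λ t → 3 + (6 * t + 4) + 3 + 3) (length-filterᵇ (arc D i) (allFin (k D))) ⟩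
      3 + (6 * outDegree i + 4) + 3 + 3                             ≡⟨ collect (outDegree i) ⟩
      6 * outDegree i + 13                                          ∎
      where
      collect : ∀ d → 3 + (6 * d + 4) + 3 + 3 ≡ 6 * d + 13
      collect = solve-∀

  len-conflictFormula : len conflictFormula ≡ 2 * len arcFormula + 23
  len-conflictFormula = count (len arcFormula)
    where
    count : ∀ a → 6 + (a + 1) + 3 + (6 + 1 + a + 3) + 3 ≡ 2 * a + 23
    count = solve-∀

  len-realisable : len realisable ≡ len conflictFormula + 48
  len-realisable = count (len conflictFormula)
    where
    count : ∀ c → 3 + 2 + (3 + (3 + (3 + (3 + (3 + 1 + c + 3) + 3) + 3 + 2) + 3 + 1) + 3 + 2 + 1) + 3 + 2 + 1
                  ≡ c + 48
    count = solve-∀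

  len-realisable≤ : len realisable ≤ 79 * (size D + 1)
  len-realisable≤ = begin
    len realisable                                 ≡⟨ len-realisable ⟩
    len conflictFormula + 48                       ≡⟨ cong (_+ 48) len-conflictFormula ⟩
    2 * len arcFormula + 23 + 48                   ≡⟨ cong (λ a → 2 * a + 23 + 48) len-arcFormula ⟩
    2 * (6 * nArcs D + 13 * k D + 4) + 23 + 48     ≤⟨ m≤m+n _ (53 * k D + 67 * nArcs D) ⟩
    2 * (6 * nArcs D + 13 * k D + 4) + 23 + 48 + (53 * k D + 67 * nArcs D) ≡⟨ collect (k D) (nArcs D) ⟩
    79 * (size D + 1)                              ∎
    where
    open ≤-Reasoning
    collect : ∀ k a → 2 * (6 * a + 13 * k + 4) + 23 + 48 + (53 * k + 67 * a) ≡ 79 * (k + a + 1)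
    collect = solve-∀

-- Realisations of G[Z]

module Realisation (D : Decoder) (G : Graph) (Z : Subset (n G)) (ℓ : Labelling G Z (k D)) where

  open DecoderFormula D

  V : Set
  V = VZ G Z

  Conflict : Rel V 0ℓ
  Conflict (x , p) (y , q) = x ≢ y × adj G x y ≢ arc D (ℓ x p) (ℓ y q)

  conflict? : Decidable Conflict
  conflict? (x , p) (y , q) = ¬? (x ≟ y) ×-dec ¬? (adj G x y ≟ᵇ arc D (ℓ x p) (ℓ y q))

  module _ {m} (c : V ⤖ Fin m) where

    open Bijection c using (to; injective)

    Clause : V → V → Set
    Clause u w = (T (arc D (labelZ G Z ℓ u) (labelZ G Z ℓ w)) × to u < to w)
               ⊎ (T (arc D (labelZ G Z ℓ w) (labelZ G Z ℓ u)) × to w < to u)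

    Clause-< : ∀ {u w} → to u < to w → Clause u w ⇔ T (arc D (labelZ G Z ℓ u) (labelZ G Z ℓ w))
    Clause-< u<w = mk⇔ (λ { (inj₁ (t , _)) → t ; (inj₂ (_ , w<u)) → contradiction w<u (<-asym u<w) })
                       (λ t → inj₁ (t , u<w))

    Clause-> : ∀ {u w} → to w < to u → Clause u w ⇔ T (arc D (labelZ G Z ℓ w) (labelZ G Z ℓ u))
    Clause-> w<u = mk⇔ (λ { (inj₁ (_ , u<w)) → contradiction u<w (<-asym w<u) ; (inj₂ (t , _)) → t })
                       (λ t → inj₂ (t , w<u))

    realisation⇔descending : IsLetterRealisation D (EZ G Z) m (labelZ G Z ℓ) c ⇔ Descending Conflict to
    realisation⇔descending = mk⇔ descending realisation
      where
      descending : IsLetterRealisation D (EZ G Z) m (labelZ G Z ℓ) c → Descending Conflict to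
      descending real {u} {w} (x≢y , mismatch) with <-cmp (to u) (to w)
      ... | tri< u<w _ _ = contradiction (T⇔T⇒≡ (Clause-< u<w ⇔-∘ real u w (x≢y ∘ cong proj₁))) mismatch
      ... | tri≈ _ u≡w _ = contradiction (cong proj₁ (injective u≡w)) x≢y
      ... | tri> _ _ w<u = w<u

      agreement : Descending Conflict to → ∀ {u w} → proj₁ u ≢ proj₁ w → to u < to w →
                  adj G (proj₁ u) (proj₁ w) ≡ arc D (labelZ G Z ℓ u) (labelZ G Z ℓ w)
      agreement desc x≢y u<w = decidable-stable (_ ≟ᵇ _) λ mismatch → <-asym u<w (desc (x≢y , mismatch))

      realisation : Descending Conflict to → IsLetterRealisation D (EZ G Z) m (labelZ G Z ℓ) c
      realisation desc u@(x , _) w@(y , _) u≢w with <-cmp (to u) (to w)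
      ... | tri< u<w _ _ =
        ⇔-sym (Clause-< u<w) ⇔-∘ ≡⇒⇔ (cong T (agreement desc (u≢w ∘ ∈-proj₁-injective) u<w))
      ... | tri≈ _ u≡w _ = contradiction (injective u≡w) u≢w
      ... | tri> _ _ w<u = ⇔-sym (Clause-> w<u) ⇔-∘ ≡⇒⇔ (cong T
        (trans (Graph.sym G x y) (agreement desc (u≢w ∘ ≡.sym ∘ ∈-proj₁-injective) w<u)))

  lookup-preimage : ∀ {x i} (p : x ∈ Z) → lookup (preimage G Z ℓ i) x ≡ does (ℓ x p ≟ i)
  lookup-preimage {x} {i} p with x ∈? Z | (lookup (preimage G Z ℓ i) x ≡ _ ∋ lookup∘tabulate _ x)
  ... | yes p′ | lookup≡ rewrite []=-irrelevant p p′ = lookup≡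
  ... | no ¬p  | _       = contradiction p ¬p

  ∈-preimage : ∀ {x i} (p : x ∈ Z) → x ∈ preimage G Z ℓ i ⇔ ℓ x p ≡ i
  ∈-preimage {x} {i} p = mk⇔
    (λ x∈ → sound (trans (≡.sym (lookup-preimage p)) ([]=⇒lookup x∈)))
    (λ ℓx≡i → lookup⇒[]= x _ (trans (lookup-preimage p) (dec-true (ℓ x p ≟ i) ℓx≡i)))
    where
    sound : does (ℓ x p ≟ i) ≡ true → ℓ x p ≡ i
    sound with ℓ x p ≟ i
    ... | yes ℓx≡i = λ _ → ℓx≡i
    ... | no _     = λ ()

  module _ {ρ : Fin 2 → Fin (n G)} {σ : Fin (2 + k D) → Subset (n G)}
           (σ-ℓ : ∀ i → σ (varℓ i) ≡ preimage G Z ℓ i) (p : ρ varx ∈ Z) (q : ρ vary ∈ Z) where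

    open Equivalence

    Sat-arcFormula-ℓ : Sat G ρ σ arcFormula ⇔ T (arc D (ℓ _ p) (ℓ _ q))
    Sat-arcFormula-ℓ = mk⇔ read write ⇔-∘ Sat-arcFormula
      where
      labelled : ∀ {x i} (x∈ : x ∈ Z) → x ∈ σ (varℓ i) ⇔ ℓ x x∈ ≡ i
      labelled {i = i} x∈ = ∈-preimage x∈ ⇔-∘ ≡⇒⇔ (cong (_ ∈_) (σ-ℓ i))

      read : (∃₂ λ i j → T (arc D i j) × ρ varx ∈ σ (varℓ i) × ρ vary ∈ σ (varℓ j)) →
             T (arc D (ℓ _ p) (ℓ _ q))
      read (i , j , t , x∈ , y∈) =
        subst₂ (λ a b → T (arc D a b)) (≡.sym (to (labelled p) x∈)) (≡.sym (to (labelled q) y∈)) t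

      write : T (arc D (ℓ _ p) (ℓ _ q)) →
              ∃₂ λ i j → T (arc D i j) × ρ varx ∈ σ (varℓ i) × ρ vary ∈ σ (varℓ j)
      write t = _ , _ , t , from (labelled p) refl , from (labelled q) refl

    Sat-conflictFormula : Sat G ρ σ conflictFormula ⇔ (adj G (ρ varx) (ρ vary) ≢ arc D (ℓ _ p) (ℓ _ q))
    Sat-conflictFormula = Sat-⊻ {φ = edg varx vary} {ψ = arcFormula} (⇔-id _) Sat-arcFormula-ℓ

  descending⇒realisable : ∀ {m} {f : V → Fin m} → Descending Conflict f →
                          Sat G noVars (assignment G Z ℓ) realisable
  descending⇒realisable desc (Y , (x , x∈Y) , ¬stuck) =
    ¬stuck (x , x∈Y , λ (p , _) → ∉Y (descending⇒wellFounded desc (x , p)) x∈Y)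
    where
    ∉Y : ∀ {v} → Acc (flip Conflict) v → proj₁ v ∉ Y
    ∉Y {x , p} (acc rs) x∈Y = ¬stuck (x , x∈Y , λ (p′ , y , q , y∈Y , y≢x , conflict) →
      ∉Y (rs {y , q} (y≢x ∘ ≡.sym , subst (λ p → _ ≢ arc D (ℓ x p) _) ([]=-irrelevant p′ p)
                                          (Equivalence.to (Sat-conflictFormula (λ _ → refl) p′ q) conflict)))
         y∈Y)

  open Inverse (enumerate Z) using (strictlyInverseˡ; strictlyInverseʳ)
    renaming (to to position; from to element)

  embedAt : Subset ∣ Z ∣ → (x : Fin (n G)) → Dec (x ∈ Z) → Bool
  embedAt S x (yes p) = lookup S (position (x , p))
  embedAt S x (no _)  = false

  embed : Subset ∣ Z ∣ → Subset (n G)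
  embed S = tabulate λ x → embedAt S x (x ∈? Z)

  embed-∈ : ∀ {S x} (p : x ∈ Z) → position (x , p) ∈ S → x ∈ embed S
  embed-∈ {S} {x} p pos∈S with x ∈? Z | lookup∘tabulate (λ x → embedAt S x (x ∈? Z)) x
  ... | yes p′ | lookup≡ rewrite []=-irrelevant p p′ = lookup⇒[]= x _ (trans lookup≡ ([]=⇒lookup pos∈S))
  ... | no ¬p  | _       = contradiction p ¬p

  ∈-embed : ∀ {S x} → x ∈ embed S → Σ (x ∈ Z) λ p → position (x , p) ∈ S
  ∈-embed {S} {x} x∈ with x ∈? Z | trans (≡.sym (lookup∘tabulate (λ x → embedAt S x (x ∈? Z)) x)) ([]=⇒lookup x∈)
  ... | yes p | lookup≡ = p , lookup⇒[]= _ S lookup≡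
  ... | no _  | ()

  realisable⇒acyclic : Sat G noVars (assignment G Z ℓ) realisable → Acyclic (Conflict on element)
  realisable⇒acyclic sat S (i , i∈S) closed =
    sat (embed S , (proj₁ (element i) , element∈ i∈S) , λ (x , x∈Y , ¬succ) →
      let p , pos∈S = ∈-embed x∈Y
          j , j∈S , conflict = closed pos∈S
          x≢y , mismatch = subst (λ v → Conflict v (element j)) (strictlyInverseʳ (x , p)) conflict
      in ¬succ (p , proj₁ (element j) , proj₂ (element j) , element∈ j∈S , x≢y ∘ ≡.sym ,
                Equivalence.from (Sat-conflictFormula (λ _ → refl) p (proj₂ (element j))) mismatch))
    where
    element∈ : ∀ {j} → j ∈ S → proj₁ (element j) ∈ embed S
    element∈ {j} j∈S = embed-∈ (proj₂ (element j)) (subst (_∈ S) (≡.sym (strictlyInverseˡ j)) j∈S)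

proposition3p3 : Σ ℕ λ C → (D : Decoder) →
    Σ (Formula 0 (suc (k D))) λ φ →
      (len φ ≤ C * (size D + 1))
      × ((G : Graph) (Z : Subset (n G)) (ℓ : Labelling G Z (k D)) →
          (Σ (VZ G Z ⤖ Fin ∣ Z ∣) λ c →
              IsLetterRealisation D (EZ G Z) ∣ Z ∣ (labelZ G Z ℓ) c)
          ⇔ Sat G noVars (assignment G Z ℓ) φ)
proposition3p3 = 79 , λ D → realisable D , len-realisable≤ D , λ G Z ℓ →
  let open Realisation D G Z ℓ in
  mk⇔ (λ (c , real) → descending⇒realisable (Equivalence.to (realisation⇔descending c) real))
      (λ sat → let c , desc = linearExtension (enumerate Z) conflict? (realisable⇒acyclic sat)
               in c , Equivalence.from (realisation⇔descending c) desc)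
  where open DecoderFormula using (realisable; len-realisable≤)
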